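{- Let $k\ge 3$ be an integer and let $G$ be a $k$-tree. Then $\overrightarrow{\beta}(G,1)\ge \max\{2,k-2\}$.
   Context: A $k$-tree is either a complete graph on $k+1$ vertices or a graph obtained from a $k$-tree by adding a new vertex adjacent to each of $k$ vertices that form a clique. Firefighting on oriented graphs: an orientation $\overrightarrow{G}$ of a finite simple graph $G$ replaces each edge $uv$ by exactly one of the arcs $\overrightarrow{uv}$, $\overrightarrow{vu}$. Let $f\ge 1$ be an integer. A fire breaks out at a vertex $v$ at time $1$ ($v$ burns). At the end of each time unit, the firefighters permanently protect up to $f$ vertices that are neither burning nor already protected. At the next time unit, every vertex that is neither burning nor protected and is an out-neighbour of a burning vertex starts to burn. The process ends when no new vertex can burn. $\beta(\overrightarrow{G},f)$ is the maximum, over all starting vertices $v$, of the minimum, over all protection strategies, of the number of vertices that burn. $\overrightarrow{\beta}(G,f)$ is the minimum of $\beta(\overrightarrow{G},f)$ over all orientations $\overrightarrow{G}$ of $G$. -}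

module Defs where

open import Data.Nat using (ℕ; zero; suc; _+_; _≤_; _∸_; _⊔_)
open import Data.Fin using (Fin; zero; suc; _≟_)
open import Data.Fin.Permutation using (Permutation′; _⟨$⟩ʳ_)
open import Data.Bool using (Bool; true; false; not; _∧_; _∨_; if_then_else_)
open import Data.Product using (Σ; ∃; _×_; _,_; proj₁; proj₂)
open import Data.Sum using (_⊎_)
open import Relation.Nullary using (¬_)
open import Relation.Nullary.Decidable using (⌊_⌋)
open import Relation.Binary.PropositionalEquality using (_≡_; _≢_)

Sub : ℕ → Set
Sub n = Fin n → Bool

∅ : ∀ {n} → Sub n
∅ _ = false

｛_｝ : ∀ {n} → Fin n → Sub n
｛ v ｝ u = ⌊ u ≟ v ⌋

_∪_ : ∀ {n} → Sub n → Sub n → Sub n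
(A ∪ B) u = A u ∨ B u

count : ∀ {n} → Sub n → ℕ
count {zero}  S = 0
count {suc n} S = (if S zero then 1 else 0) + count (λ i → S (suc i))

anyFin : ∀ {n} → (Fin n → Bool) → Bool
anyFin {zero}  p = false
anyFin {suc n} p = p zero ∨ anyFin (λ i → p (suc i))

Graph : ℕ → Set
Graph n = Fin n → Fin n → Bool

complete : (n : ℕ) → Graph n
complete n i j = not ⌊ i ≟ j ⌋

IsClique : ∀ {n} → Graph n → Sub n → Set
IsClique G S = ∀ i j → S i ≡ true → S j ≡ true → i ≢ j → G i j ≡ true

-- Add a new vertex (the vertex zero; old vertex i becomes suc i)
-- adjacent exactly to the vertices of S.
addVertex : ∀ {n} → Graph n → Sub n → Graph (suc n)
addVertex G S zero    zero    = false
addVertex G S zero    (suc j) = S j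
addVertex G S (suc i) zero    = S i
addVertex G S (suc i) (suc j) = G i j

-- The class is closed under relabelling the
-- vertices (isomorphism), since "G is a k-tree" is an isomorphism-invariant
-- property of the graph G.
data KTree (k : ℕ) : (n : ℕ) → Graph n → Set where
  base    : KTree k (suc k) (complete (suc k))
  extend  : ∀ {n} {G : Graph n} → KTree k n G →
            (S : Sub n) → count S ≡ k → IsClique G S →
            KTree k (suc n) (addVertex G S)
  relabel : ∀ {n} {G : Graph n} → (π : Permutation′ n) → KTree k n G →
            KTree k n (λ i j → G (π ⟨$⟩ʳ i) (π ⟨$⟩ʳ j))

-- Orientations: D i j ≡ true means the arc i → j.

IsOrientation : ∀ {n} → Graph n → Graph n → Set
IsOrientation G D =
    (∀ i j → D i j ≡ true → G i j ≡ true)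
  × (∀ i j → G i j ≡ true → (D i j ≡ true) ⊎ (D j i ≡ true))
  × (∀ i j → D i j ≡ true → D j i ≡ false)

-- A protection strategy: the set of vertices protected at the end of
-- time unit t+1 (t = 0, 1, 2, ...).
Strategy : ℕ → Set
Strategy n = ℕ → Sub n

-- State (burning set, protected set) at time t+1, when the fire starts
-- at v at time 1 and the firefighters play σ.
state : ∀ {n} → Graph n → Fin n → Strategy n → ℕ → Sub n × Sub n
state D v σ zero = ｛ v ｝ , ∅
state D v σ (suc t) =
  let B  = proj₁ (state D v σ t)
      P′ = proj₂ (state D v σ t) ∪ σ t
  in (λ u → B u ∨ (not (P′ u) ∧ anyFin (λ w → B w ∧ D w u))) , P′

burning : ∀ {n} → Graph n → Fin n → Strategy n → ℕ → Sub n
burning D v σ t = proj₁ (state D v σ t)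

protected : ∀ {n} → Graph n → Fin n → Strategy n → ℕ → Sub n
protected D v σ t = proj₂ (state D v σ t)

Legal : ∀ {n} → ℕ → Graph n → Fin n → Strategy n → Set
Legal f D v σ = ∀ t → count (σ t) ≤ f ×
  (∀ u → σ t u ≡ true → (burning D v σ t u ≡ false) × (protected D v σ t u ≡ false))

-- The burning sets increase with time and the number of burnt vertices is
-- the size of the final burning set, so this holds iff some burning set
-- has size ≥ m.
BurnsAtLeast : ∀ {n} → ℕ → Graph n → Fin n → Strategy n → Set
BurnsAtLeast m D v σ = ∃ λ t → m ≤ count (burning D v σ t)

-- β(D, f) ≥ m  (max over v of min over legal strategies of #burnt ≥ m)
βAtLeast : ∀ {n} → Graph n → ℕ → ℕ → Set
βAtLeast {n} D f m = Σ (Fin n) λ v → ∀ (σ : Strategy n) → Legal f D v σ → BurnsAtLeast m D v σ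

-- β⃗(G, f) ≥ m  (min over orientations D of G of β(D, f) ≥ m)
βOrAtLeast : ∀ {n} → Graph n → ℕ → ℕ → Set
βOrAtLeast G f m = ∀ D → IsOrientation G D → βAtLeast D f m

module Submission where

-- Any orientation of a graph G containing a clique on k+1 ≥ 4 vertices
-- lets one fire, with one firefighter, burn at least max{2, k−2} vertices.
--
-- The orientation restricted to the clique is a tournament.  Let the fire
-- start at a vertex i of maximum out-degree d; a short counting argument
-- gives d ≥ 2.  The firefighters protect one vertex before the first
-- spread, so at least d−1 out-neighbours of i burn at time 2.  At time 3
-- every clique vertex burns except the two protected ones and the
-- "stranded" in-neighbours of i, those not entered by any burning
-- out-neighbour.  Two stranded vertices j → j′ are impossible: j would
-- dominate i, j′ and all burning out-neighbours, giving it out-degree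
-- above d.  Hence at most three clique vertices escape (bound k−2), and
-- i together with its burning out-neighbours gives at least d ≥ 2.

open import Defs
open import Data.Nat using (ℕ; zero; suc; _+_; _≤_; _<_; _∸_; _⊔_; z≤n; s≤s; s≤s⁻¹; _≤?_)
open import Data.Nat.Properties
  using (≤-refl; ≤-trans; <⇒≤; ≤-reflexive; ≤-antisym; +-mono-≤; +-monoʳ-≤; m≤n+m;
         m≤n+o⇒m∸n≤o; <⇒≱; ≰⇒>; ⊔-lub; +-comm; +-commutativeSemigroup)
open import Algebra.Properties.CommutativeSemigroup +-commutativeSemigroup using (interchange)
open import Data.Fin using (Fin; zero; suc; _≟_)
open import Data.Fin.Properties using (suc-injective)
open import Data.Fin.Permutation using (_⟨$⟩ʳ_; _⟨$⟩ˡ_; inverseʳ)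
open import Data.Bool using (Bool; true; false; not; _∧_; _∨_; if_then_else_)
open import Data.Bool.Properties using (∨-zeroʳ; ∧-zeroʳ; ∨-conicalˡ; ∨-conicalʳ; ∧-conicalˡ; ∧-conicalʳ)
open import Data.Product using (Σ; _×_; _,_; proj₁; proj₂)
open import Data.Sum using (_⊎_; inj₁; inj₂)
open import Data.Empty using (⊥)
open import Relation.Nullary using (yes; no; contradiction)
open import Relation.Binary.PropositionalEquality using (_≡_; _≢_; refl; sym; trans; cong; cong₂; subst₂)

_∈_ : ∀ {n} → Fin n → Sub n → Set
x ∈ S = S x ≡ true

_⊆_ : ∀ {n} → Sub n → Sub n → Set
S ⊆ T = ∀ x → x ∈ S → x ∈ T

Disjoint : ∀ {n} → Sub n → Sub n → Set
Disjoint S T = ∀ x → x ∈ S → T x ≡ false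

⊆-∉ : ∀ {n} {S T : Sub n} {u} → S ⊆ T → T u ≡ false → S u ≡ false
⊆-∉ {S = S} {u = u} S⊆T u∉T with S u in u∈S
... | true  = trans (sym (S⊆T u u∈S)) u∉T
... | false = refl

_∖_ : ∀ {n} → Sub n → Sub n → Sub n
(S ∖ T) u = S u ∧ not (T u)

∖-⊆ : ∀ {n} {S T : Sub n} → (S ∖ T) ⊆ S
∖-⊆ _ u∈S∖T = ∧-conicalˡ _ _ u∈S∖T

∖-intro : ∀ {n} {S T : Sub n} {u} → u ∈ S → T u ≡ false → u ∈ (S ∖ T)
∖-intro u∈S u∉T rewrite u∈S | u∉T = refl

∖-elim : ∀ {n} {S T : Sub n} {u} → u ∈ (S ∖ T) → (u ∈ S) × (T u ≡ false)
∖-elim {S = S} {T} {u} u∈S∖T with S u | T u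
∖-elim refl | true | false = refl , refl

∉-∖ : ∀ {n} {S T : Sub n} {u} → u ∈ T → (S ∖ T) u ≡ false
∉-∖ {S = S} {u = u} u∈T rewrite u∈T = ∧-zeroʳ (S u)

∪-introˡ : ∀ {n} {S T : Sub n} {u} → u ∈ S → u ∈ (S ∪ T)
∪-introˡ u∈S rewrite u∈S = refl

∪-introʳ : ∀ {n} {S T : Sub n} {u} → u ∈ T → u ∈ (S ∪ T)
∪-introʳ {S = S} {u = u} u∈T rewrite u∈T = ∨-zeroʳ (S u)

∉-∪ : ∀ {n} {S T : Sub n} {u} → (S ∪ T) u ≡ false → (S u ≡ false) × (T u ≡ false)
∉-∪ u∉S∪T = ∨-conicalˡ _ _ u∉S∪T , ∨-conicalʳ _ _ u∉S∪T

∪-elim : ∀ {n} {S T : Sub n} {u} → u ∈ (S ∪ T) → (u ∈ S) ⊎ (u ∈ T)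
∪-elim {S = S} {u = u} u∈S∪T with S u
... | true  = inj₁ refl
... | false = inj₂ u∈S∪T

∖-complement : ∀ {n} {S T : Sub n} {u} → u ∈ S → (S ∖ T) u ≡ false → u ∈ T
∖-complement {S = S} {T} {u} u∈S _ with S u | T u
∖-complement refl refl | true | true = refl

indicator : Bool → ℕ
indicator b = if b then 1 else 0

indicator-mono : ∀ {a b} → (a ≡ true → b ≡ true) → indicator a ≤ indicator b
indicator-mono {false} _ = z≤n
indicator-mono {true} a⇒b rewrite a⇒b refl = ≤-refl

indicator-∨ : ∀ a b → indicator (a ∨ b) ≤ indicator a + indicator b
indicator-∨ false b = ≤-refl
indicator-∨ true  b = s≤s z≤n

indicator-∨-disjoint : ∀ {a b} → (a ≡ true → b ≡ false) → indicator (a ∨ b) ≡ indicator a + indicator b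
indicator-∨-disjoint {false} _ = refl
indicator-∨-disjoint {true} a⇒¬b rewrite a⇒¬b refl = refl

count-mono : ∀ {n} {S T : Sub n} → S ⊆ T → count S ≤ count T
count-mono {zero}  _   = z≤n
count-mono {suc n} S⊆T = +-mono-≤ (indicator-mono (S⊆T zero)) (count-mono (λ x → S⊆T (suc x)))

count-∪ : ∀ {n} (S T : Sub n) → count (S ∪ T) ≤ count S + count T
count-∪ {zero}  S T = z≤n
count-∪ {suc n} S T =
  ≤-trans (+-mono-≤ (indicator-∨ (S zero) (T zero)) (count-∪ (λ x → S (suc x)) (λ x → T (suc x))))
          (≤-reflexive (interchange (indicator (S zero)) (indicator (T zero)) _ _))

count-∪-disjoint : ∀ {n} {S T : Sub n} → Disjoint S T → count (S ∪ T) ≡ count S + count T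
count-∪-disjoint {zero}  _ = refl
count-∪-disjoint {suc n} {S} {T} S#T =
  trans (cong₂ _+_ (indicator-∨-disjoint (S#T zero)) (count-∪-disjoint (λ x → S#T (suc x))))
        (interchange (indicator (S zero)) (indicator (T zero)) _ _)

count-full : ∀ n → count {n} (λ _ → true) ≡ n
count-full zero    = refl
count-full (suc n) = cong suc (count-full n)

count-∅ : ∀ n → count {n} ∅ ≡ 0
count-∅ zero    = refl
count-∅ (suc n) = count-∅ n

count-cover : ∀ {n} {S T : Sub n} → (λ _ → true) ⊆ (S ∪ T) → n ≤ count S + count T
count-cover {n} {S} {T} cover =
  ≤-trans (≤-reflexive (sym (count-full n))) (≤-trans (count-mono cover) (count-∪ S T))

count-≤1 : ∀ {n} (S : Sub n) → (∀ {x y} → x ∈ S → y ∈ S → x ≡ y) → count S ≤ 1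
count-≤1 {zero}  S _ = z≤n
count-≤1 {suc n} S unique with S zero in 0∈S
... | true  = s≤s (≤-trans (count-mono tail⊆∅) (≤-reflexive (count-∅ n)))
  where
  tail⊆∅ : (λ x → S (suc x)) ⊆ ∅
  tail⊆∅ x x∈S = contradiction (unique 0∈S x∈S) λ ()
... | false = count-≤1 (λ x → S (suc x)) (λ x∈S y∈S → suc-injective (unique x∈S y∈S))

count-member : ∀ {n} {S : Sub n} {x} → x ∈ S → 1 ≤ count S
count-member {S = S} {zero}  x∈S rewrite x∈S = s≤s z≤n
count-member {S = S} {suc x} x∈S = ≤-trans (count-member {S = λ y → S (suc y)} x∈S) (m≤n+m _ _)

∈-｛｝ : ∀ {n} (x : Fin n) → x ∈ ｛ x ｝
∈-｛｝ x with x ≟ x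
... | yes _   = refl
... | no x≢x = contradiction refl x≢x

∈-｛｝⇒≡ : ∀ {n} {u x : Fin n} → u ∈ ｛ x ｝ → u ≡ x
∈-｛｝⇒≡ {u = u} {x} _ with u ≟ x
... | yes u≡x = u≡x

∉-｛｝ : ∀ {n} {u x : Fin n} → u ≢ x → ｛ x ｝ u ≡ false
∉-｛｝ {u = u} {x} u≢x with u ≟ x
... | yes u≡x = contradiction u≡x u≢x
... | no _    = refl

count-｛｝ : ∀ {n} (x : Fin n) → count ｛ x ｝ ≡ 1
count-｛｝ x = ≤-antisym (count-≤1 ｛ x ｝ (λ u∈ v∈ → trans (∈-｛｝⇒≡ u∈) (sym (∈-｛｝⇒≡ v∈))))
                        (count-member {S = ｛ x ｝} (∈-｛｝ x))

count-insert : ∀ {n} {x : Fin n} {S : Sub n} → S x ≡ false → count (｛ x ｝ ∪ S) ≡ suc (count S)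
count-insert {x = x} {S} x∉S =
  trans (count-∪-disjoint {S = ｛ x ｝} {S} (λ u u∈｛x｝ → trans (cong _ (∈-｛｝⇒≡ u∈｛x｝)) x∉S))
        (cong (_+ _) (count-｛｝ x))

count-∖ : ∀ {n} (S T : Sub n) → count S ≤ count (S ∖ T) + count T
count-∖ S T = ≤-trans (count-mono cover) (count-∪ (S ∖ T) T)
  where
  cover : S ⊆ ((S ∖ T) ∪ T)
  cover u u∈S with T u
  ... | true  = ∨-zeroʳ _
  ... | false rewrite u∈S = refl

count-remove : ∀ {n} (S : Sub n) (x : Fin n) → indicator (S x) + count (S ∖ ｛ x ｝) ≤ count S
count-remove S x with S x in x∈S
... | true  = ≤-trans (≤-reflexive (sym (count-insert {x = x} {S ∖ ｛ x ｝} x∉S∖x)))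
                      (count-mono {T = S} insert⊆S)
  where
  x∉S∖x : (S ∖ ｛ x ｝) x ≡ false
  x∉S∖x = ∉-∖ {S = S} {｛ x ｝} (∈-｛｝ x)
  insert⊆S : (｛ x ｝ ∪ (S ∖ ｛ x ｝)) ⊆ S
  insert⊆S u u∈ with ∪-elim {S = ｛ x ｝} {S ∖ ｛ x ｝} u∈
  ... | inj₁ u∈｛x｝ = trans (cong S (∈-｛｝⇒≡ u∈｛x｝)) x∈S
  ... | inj₂ u∈S∖x = proj₁ (∖-elim {S = S} {｛ x ｝} u∈S∖x)
... | false = count-mono {S = S ∖ ｛ x ｝} (∖-⊆ {T = ｛ x ｝})

count-comap : ∀ {m n} (c : Fin m → Fin n) → (∀ {i j} → c i ≡ c j → i ≡ j) →
              (S : Sub n) → count (λ i → S (c i)) ≤ count S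
count-comap {zero}  c injective S = z≤n
count-comap {suc m} c injective S =
  ≤-trans (+-monoʳ-≤ (indicator (S (c zero))) later-≤) (count-remove S (c zero))
  where
  later⊆ : (λ i → S (c (suc i))) ⊆ (λ i → (S ∖ ｛ c zero ｝) (c (suc i)))
  later⊆ i i∈S =
    ∖-intro {S = S} {｛ c zero ｝} i∈S (∉-｛｝ (λ eq → contradiction (injective eq) λ ()))
  later-≤ : count (λ i → S (c (suc i))) ≤ count (S ∖ ｛ c zero ｝)
  later-≤ = ≤-trans (count-mono {T = λ i → (S ∖ ｛ c zero ｝) (c (suc i))} later⊆)
                    (count-comap (λ i → c (suc i)) (λ eq → suc-injective (injective eq)) (S ∖ ｛ c zero ｝))

anyFin-intro : ∀ {n} (p : Fin n → Bool) (w : Fin n) → p w ≡ true → anyFin p ≡ true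
anyFin-intro p zero    pw rewrite pw = refl
anyFin-intro p (suc w) pw with p zero
... | true  = refl
... | false = anyFin-intro (λ i → p (suc i)) w pw

anyFin-elim : ∀ {n} (p : Fin n → Bool) → anyFin p ≡ true → Σ (Fin n) λ w → p w ≡ true
anyFin-elim {suc n} p any with p zero in p0
... | true  = zero , p0
... | false with anyFin-elim (λ i → p (suc i)) any
...   | w , pw = suc w , pw

argmax : ∀ {m} (f : Fin (suc m) → ℕ) → Σ (Fin (suc m)) λ i → ∀ j → f j ≤ f i
argmax {zero}  f = zero , λ { zero → ≤-refl }
argmax {suc m} f with argmax (λ i → f (suc i))
... | i , max with f zero ≤? f (suc i)
...   | yes f0≤ = suc i , λ { zero → f0≤ ; (suc j) → max j }
...   | no  f0≰ = zero , λ { zero → ≤-refl ; (suc j) → ≤-trans (max j) (<⇒≤ (≰⇒> f0≰)) }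

spread : ∀ {n} {D : Graph n} {v σ t w u} → burning D v σ t w ≡ true → D w u ≡ true →
         protected D v σ (suc t) u ≡ false → burning D v σ (suc t) u ≡ true
spread {D = D} {v} {σ} {t} {w} {u} w-burns w→u u-free
  rewrite u-free | anyFin-intro (λ w′ → burning D v σ t w′ ∧ D w′ u) w (cong₂ _∧_ w-burns w→u)
  = ∨-zeroʳ (burning D v σ t u)

keeps-burning : ∀ {n} {D : Graph n} {v σ t u} →
                burning D v σ t u ≡ true → burning D v σ (suc t) u ≡ true
keeps-burning u-burns rewrite u-burns = refl

record Clique {n} (m : ℕ) (G : Graph n) : Set where
  field
    vertex    : Fin m → Fin n
    injective : ∀ {i j} → vertex i ≡ vertex j → i ≡ j
    adjacent  : ∀ {i j} → i ≢ j → G (vertex i) (vertex j) ≡ true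

-- Every k-tree contains a clique on k+1 vertices: the initial complete graph,
-- which survives extensions and is transported along relabellings.
ktree-clique : ∀ {k n G} → KTree k n G → Clique (suc k) G
ktree-clique base = record
  { vertex = λ i → i ; injective = λ i≡j → i≡j ; adjacent = λ i≢j → cong not (∉-｛｝ i≢j) }
ktree-clique (extend t _ _ _) = record
  { vertex = λ i → suc (vertex i) ; injective = λ eq → injective (suc-injective eq) ; adjacent = adjacent }
  where open Clique (ktree-clique t)
ktree-clique (relabel {G = G} π t) = record
  { vertex    = λ i → π ⟨$⟩ˡ vertex i
  ; injective = λ eq → injective (trans (sym (inverseʳ π)) (trans (cong (π ⟨$⟩ʳ_) eq) (inverseʳ π)))
  ; adjacent  = λ i≢j → subst₂ (λ a b → G a b ≡ true) (sym (inverseʳ π)) (sym (inverseʳ π)) (adjacent i≢j)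
  }
  where open Clique (ktree-clique t)

record Tournament (m : ℕ) : Set where
  field
    arc   : Fin m → Fin m → Bool
    total : ∀ {i j} → i ≢ j → (arc i j ≡ true) ⊎ (arc j i ≡ true)
    asym  : ∀ {i j} → arc i j ≡ true → arc j i ≡ false

induced : ∀ {n m} {G D : Graph n} → IsOrientation G D → Clique m G → Tournament m
induced {D = D} (_ , oriented , one-way) C = record
  { arc = λ i j → D (vertex i) (vertex j)
  ; total = λ i≢j → oriented _ _ (adjacent i≢j)
  ; asym = one-way _ _
  }
  where open Clique C

module TournamentProperties {m} (T : Tournament m) where
  open Tournament T

  outdeg : Fin m → ℕ
  outdeg i = count (arc i)

  irreflexive : ∀ i → arc i i ≡ false
  irreflexive i with arc i i in i→i
  ... | true  = trans (sym i→i) (asym i→i)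
  ... | false = refl

  no-2-cycle : ∀ {i j} → arc i j ≡ true → arc j i ≡ true → ⊥
  no-2-cycle i→j j→i = contradiction (trans (sym j→i) (asym i→j)) λ ()

  arc⇒≢ : ∀ {i j} → arc i j ≡ true → i ≢ j
  arc⇒≢ i→j refl = no-2-cycle i→j i→j

  arc-free-≤1 : (X : Sub m) → (∀ {j j′} → j ∈ X → j′ ∈ X → arc j j′ ≡ true → ⊥) → count X ≤ 1
  arc-free-≤1 X arc-free = count-≤1 X unique
    where
    unique : ∀ {j j′} → j ∈ X → j′ ∈ X → j ≡ j′
    unique {j} {j′} j∈X j′∈X with j ≟ j′
    ... | yes j≡j′ = j≡j′
    ... | no  j≢j′ with total j≢j′
    ...   | inj₁ j→j′ = contradiction j→j′ (arc-free j∈X j′∈X)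
    ...   | inj₂ j′→j = contradiction j′→j (arc-free j′∈X j∈X)

  module MaxOutdegree (i : Fin m) (maximal : ∀ j → outdeg j ≤ outdeg i) where

    overfull-≤1 : (X : Sub m) → (∀ {j j′} → j ∈ X → j′ ∈ X → arc j j′ ≡ true → outdeg i < outdeg j) →
                  count X ≤ 1
    overfull-≤1 X overfull = arc-free-≤1 X λ j∈X j′∈X j→j′ → <⇒≱ (overfull j∈X j′∈X j→j′) (maximal _)

    -- With at least four vertices, i has out-degree at least 2: otherwise its
    -- in-neighbourhood spans no arc, so at most 1 + 1 + 1 vertices exist.
    outdeg≥2 : 4 ≤ m → 2 ≤ outdeg i
    outdeg≥2 4≤m with 2 ≤? outdeg i
    ... | yes 2≤d = 2≤d
    ... | no  2≰d = contradiction (≤-trans 4≤m m≤3) λ { (s≤s (s≤s (s≤s ()))) }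
      where
      d≤1 : outdeg i ≤ 1
      d≤1 = s≤s⁻¹ (≰⇒> 2≰d)
      in-nbrs : Sub m
      in-nbrs j = arc j i
      in-arc⇒outdeg≥2 : ∀ {j j′} → j ∈ in-nbrs → j′ ∈ in-nbrs → arc j j′ ≡ true → 2 ≤ outdeg j
      in-arc⇒outdeg≥2 {j} {j′} j→i j′→i j→j′ =
        ≤-trans (≤-reflexive (sym pair-size)) (count-mono {T = arc j} pair⊆out)
        where
        pair-size : count (｛ i ｝ ∪ ｛ j′ ｝) ≡ 2
        pair-size = trans (count-insert {S = ｛ j′ ｝} (∉-｛｝ (λ i≡j′ → arc⇒≢ j′→i (sym i≡j′))))
                          (cong suc (count-｛｝ j′))
        pair⊆out : (｛ i ｝ ∪ ｛ j′ ｝) ⊆ arc j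
        pair⊆out u u∈ with ∪-elim {S = ｛ i ｝} {｛ j′ ｝} u∈
        ... | inj₁ u∈｛i｝  = trans (cong (arc j) (∈-｛｝⇒≡ u∈｛i｝)) j→i
        ... | inj₂ u∈｛j′｝ = trans (cong (arc j) (∈-｛｝⇒≡ u∈｛j′｝)) j→j′
      in-≤1 : count in-nbrs ≤ 1
      in-≤1 = overfull-≤1 in-nbrs λ j→i j′→i j→j′ → ≤-trans (s≤s d≤1) (in-arc⇒outdeg≥2 j→i j′→i j→j′)
      everyone : (λ _ → true) ⊆ (｛ i ｝ ∪ (arc i ∪ in-nbrs))
      everyone u _ with u ≟ i
      ... | yes _   = refl
      ... | no  u≢i with total u≢i
      ...   | inj₁ u→i = ∪-introʳ {S = arc i} {in-nbrs} u→i
      ...   | inj₂ i→u = ∪-introˡ {S = arc i} {in-nbrs} i→u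
      m≤3 : m ≤ 3
      m≤3 = ≤-trans (count-cover everyone)
              (+-mono-≤ (≤-reflexive (count-｛｝ i))
                        (≤-trans (count-∪ (arc i) in-nbrs) (+-mono-≤ d≤1 in-≤1)))

module CliqueFire {n k} {G D : Graph n} (k≥3 : 3 ≤ k) (C : Clique (suc k) G)
                  (orientation : IsOrientation G D) where
  open Clique C
  open Tournament (induced orientation C)
  open TournamentProperties (induced orientation C)

  king : Fin (suc k)
  king = proj₁ (argmax outdeg)

  open MaxOutdegree king (proj₂ (argmax outdeg))

  source : Fin n
  source = vertex king

  module Against (σ : Strategy n) (legal : Legal 1 D source σ) where

    burns : ℕ → Sub (suc k)
    burns t j = burning D source σ t (vertex j)

    shield : ℕ → Sub (suc k)
    shield t j = σ t (vertex j)

    shield-≤1 : ∀ t → count (shield t) ≤ 1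
    shield-≤1 t = ≤-trans (count-comap vertex injective (σ t)) (proj₁ (legal t))

    -- Out-neighbours of the king not protected by the first move; they burn at time 2.
    first-wave : Sub (suc k)
    first-wave = arc king ∖ shield 0

    reached : Sub (suc k)
    reached j = anyFin (λ a → first-wave a ∧ arc a j)

    stranded : Sub (suc k)
    stranded = (λ j → arc j king) ∖ reached

    -- The only clique vertices that may escape the fire up to time 3.
    exceptional : Sub (suc k)
    exceptional = (shield 0 ∪ shield 1) ∪ stranded

    ignite : ∀ t {w} u → w ∈ burns t → arc w u ≡ true →
             protected D source σ (suc t) (vertex u) ≡ false → u ∈ burns (suc t)
    ignite t {w} u = spread {D = D} {source} {σ} {t} {vertex w} {vertex u}

    stays : ∀ t u → u ∈ burns t → u ∈ burns (suc t)
    stays t u = keeps-burning {D = D} {source} {σ} {t} {vertex u}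

    source-burns : ∀ t → king ∈ burns t
    source-burns zero    = ∈-｛｝ source
    source-burns (suc t) = stays t king (source-burns t)

    first-wave-burns : ∀ {a} → a ∈ first-wave → a ∈ burns 1
    first-wave-burns {a} a∈ with ∖-elim {S = arc king} {shield 0} a∈
    ... | king→a , unshielded = ignite 0 a (source-burns 0) king→a unshielded

    ordinary-burns : ∀ j → exceptional j ≡ false → j ∈ burns 2
    ordinary-burns j j∉E with ∉-∪ {S = shield 0 ∪ shield 1} {stranded} j∉E
    ... | unshielded , unstranded with j ≟ king
    ...   | yes refl = source-burns 2
    ...   | no  j≢king with total j≢king
    ...     | inj₂ king→j =
                stays 1 j (first-wave-burns (∖-intro {S = arc king} {shield 0} king→j
                                              (proj₁ (∉-∪ {S = shield 0} {shield 1} unshielded))))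
    ...     | inj₁ j→king
              with anyFin-elim (λ a → first-wave a ∧ arc a j)
                               (∖-complement {S = λ i → arc i king} {reached} j→king unstranded)
    ...       | a , a-enters-j =
                  ignite 1 j (first-wave-burns {a} (∧-conicalˡ _ _ a-enters-j))
                         (∧-conicalʳ _ _ a-enters-j) unshielded

    king∉first-wave : first-wave king ≡ false
    king∉first-wave = ⊆-∉ {S = first-wave} {arc king} (∖-⊆ {T = shield 0}) (irreflexive king)

    -- The first move protects at most one out-neighbour of the king.
    first-wave-size : outdeg king ≤ suc (count first-wave)
    first-wave-size = ≤-trans (count-∖ (arc king) (shield 0))
                        (≤-trans (+-monoʳ-≤ (count first-wave) (shield-≤1 0)) (≤-reflexive (+-comm _ 1)))

    stranded-dominates : ∀ {j} → j ∈ stranded → first-wave ⊆ arc j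
    stranded-dominates {j} j∈ a a∈
      with ∖-elim {S = λ i → arc i king} {reached} j∈ | ∖-elim {S = arc king} {shield 0} a∈
    ... | j→king , unreached | king→a , _ with total {j} {a} (λ { refl → no-2-cycle king→a j→king })
    ...   | inj₁ j→a = j→a
    ...   | inj₂ a→j = contradiction (trans (sym reached-j) unreached) λ ()
      where
      reached-j : reached j ≡ true
      reached-j = anyFin-intro (λ b → first-wave b ∧ arc b j) a (cong₂ _∧_ a∈ a→j)

    -- Two stranded vertices j → j′ are impossible, since j would beat the
    -- king, j′ and the first wave.
    stranded-≤1 : count stranded ≤ 1
    stranded-≤1 = overfull-≤1 stranded beats
      where
      beats : ∀ {j j′} → j ∈ stranded → j′ ∈ stranded → arc j j′ ≡ true → outdeg king < outdeg j
      beats {j} {j′} j∈ j′∈ j→j′ =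
        ≤-trans (s≤s first-wave-size)
          (≤-trans (≤-reflexive (sym (trans (count-insert {S = ｛ j′ ｝ ∪ first-wave} king∉)
                                            (cong suc (count-insert {S = first-wave} j′∉)))))
                   (count-mono {T = arc j} dominated))
        where
        j′→king : arc j′ king ≡ true
        j′→king = proj₁ (∖-elim {S = λ i → arc i king} {reached} j′∈)
        j′∉ : first-wave j′ ≡ false
        j′∉ = ⊆-∉ {S = first-wave} {arc king} (∖-⊆ {T = shield 0}) (asym j′→king)
        king∉ : (｛ j′ ｝ ∪ first-wave) king ≡ false
        king∉ = cong₂ _∨_ (∉-｛｝ (λ king≡j′ → arc⇒≢ j′→king (sym king≡j′)))
                          king∉first-wave
        dominated : (｛ king ｝ ∪ (｛ j′ ｝ ∪ first-wave)) ⊆ arc j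
        dominated u u∈ with ∪-elim {S = ｛ king ｝} {｛ j′ ｝ ∪ first-wave} u∈
        ... | inj₁ u∈｛king｝ =
                trans (cong (arc j) (∈-｛｝⇒≡ u∈｛king｝)) (proj₁ (∖-elim {S = λ i → arc i king} {reached} j∈))
        ... | inj₂ u∈rest with ∪-elim {S = ｛ j′ ｝} {first-wave} u∈rest
        ...   | inj₁ u∈｛j′｝ = trans (cong (arc j) (∈-｛｝⇒≡ u∈｛j′｝)) j→j′
        ...   | inj₂ u∈wave = stranded-dominates j∈ u u∈wave

    exceptional-≤3 : count exceptional ≤ 3
    exceptional-≤3 =
      ≤-trans (count-∪ (shield 0 ∪ shield 1) stranded)
              (+-mono-≤ (≤-trans (count-∪ (shield 0) (shield 1)) (+-mono-≤ (shield-≤1 0) (shield-≤1 1)))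
                        stranded-≤1)

    burnt-on-clique : count (burns 2) ≤ count (burning D source σ 2)
    burnt-on-clique = count-comap vertex injective (burning D source σ 2)

    -- All but at most three clique vertices burn.
    all-but-three-burn : k ∸ 2 ≤ count (burning D source σ 2)
    all-but-three-burn =
      m≤n+o⇒m∸n≤o (suc k) 3
        (≤-trans (count-cover {S = exceptional} {burns 2} cover)
                 (+-mono-≤ exceptional-≤3 burnt-on-clique))
      where
      cover : (λ _ → true) ⊆ (exceptional ∪ burns 2)
      cover j _ with exceptional j in j∈E
      ... | true  = refl
      ... | false = ordinary-burns j j∈E

    -- The king and the first wave burn, and there are at least 2 of them.
    two-burn : 2 ≤ count (burning D source σ 2)
    two-burn =
      ≤-trans (outdeg≥2 (s≤s k≥3))
        (≤-trans first-wave-size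
          (≤-trans (≤-reflexive (sym (count-insert {S = first-wave} king∉first-wave)))
                   (≤-trans (count-mono {T = burns 2} burning-core) burnt-on-clique)))
      where
      burning-core : (｛ king ｝ ∪ first-wave) ⊆ burns 2
      burning-core u u∈ with ∪-elim {S = ｛ king ｝} {first-wave} u∈
      ... | inj₁ u∈｛king｝ rewrite ∈-｛｝⇒≡ u∈｛king｝ = source-burns 2
      ... | inj₂ u∈wave = stays 1 u (first-wave-burns u∈wave)

    burns-enough : BurnsAtLeast (2 ⊔ (k ∸ 2)) D source σ
    burns-enough = 2 , ⊔-lub two-burn all-but-three-burn

clique-bound : ∀ {n k} {G : Graph n} → 3 ≤ k → Clique (suc k) G → βOrAtLeast G 1 (2 ⊔ (k ∸ 2))
clique-bound k≥3 C D orientation =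
  source , λ σ legal → Against.burns-enough σ legal
  where open CliqueFire k≥3 C orientation

corollary5p1 : (k : ℕ) → 3 ≤ k → (n : ℕ) → (G : Graph n) → KTree k n G →
    βOrAtLeast G 1 (2 ⊔ (k ∸ 2))
corollary5p1 k k≥3 n G ktree = clique-bound k≥3 (ktree-clique ktree)
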